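{- Let $T$ be a tree with at least two vertices, let $v$ be a vertex of $T$, and suppose $ttr(v,T)=t$. Then for every $i$ with $1\leq i\leq t$ there exists a total transitive partition $\{V_1,V_2,\dots,V_i\}$ of $T$ such that $v\in V_i$.
   Context: A total transitive partition of order $k$ of a graph $G=(V,E)$ without isolated vertices is a partition $\{V_1,\dots,V_k\}$ of $V$ into nonempty sets such that for all $1\leq i\leq j\leq k$, every vertex of $V_j$ has a neighbour in $V_i$ (for $i=j$: every vertex of $V_i$ is adjacent to another vertex of $V_i$). The total transitive number $ttr(v,T)$ of a vertex $v$ is the maximum integer $p$ such that $v\in V_p$ for some total transitive partition $\{V_1,\dots,V_k\}$ of $T$, the maximum taken over all total transitive partitions of $T$. -}

module Defs where

open import Data.Nat using (ℕ; zero; suc; _≤_; _<_)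
open import Data.Fin using (Fin; toℕ)
open import Data.Bool using (Bool; true; false)
open import Data.List using (List; []; _∷_; length)
open import Data.List.Relation.Unary.Unique.Propositional using (Unique)
open import Data.List.Relation.Unary.Linked using (Linked)
open import Data.Product using (Σ; ∃; ∃-syntax; _×_; _,_)
open import Function using (Surjective)
open import Relation.Binary.PropositionalEquality using (_≡_)
open import Relation.Nullary using (¬_)

record Graph (n : ℕ) : Set where
  field
    adj   : Fin n → Fin n → Bool
    sym   : ∀ u v → adj u v ≡ adj v u
    irrefl : ∀ u → adj u u ≡ false

module _ {n : ℕ} (G : Graph n) where
  open Graph G

  Adj : Fin n → Fin n → Set
  Adj u v = adj u v ≡ true

  data Walk : Fin n → Fin n → Set where
    here : ∀ u → Walk u u
    step : ∀ {u w v} → Adj u w → Walk w v → Walk u v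

  Connected : Set
  Connected = ∀ u v → Walk u v

  lastOr : Fin n → List (Fin n) → Fin n
  lastOr d [] = d
  lastOr d (x ∷ xs) = lastOr x xs

  record Cycle : Set where
    field
      x₀     : Fin n
      rest   : List (Fin n)
      long   : 2 ≤ length rest
      unique : Unique (x₀ ∷ rest)
      linked : Linked Adj (x₀ ∷ rest)
      closes : Adj (lastOr x₀ rest) x₀

  Acyclic : Set
  Acyclic = ¬ Cycle

  IsTree : Set
  IsTree = Connected × Acyclic

  -- A total transitive partition of order k, encoded by the class map
  -- f : Fin n → Fin k; vertex v lies in V_{toℕ (f v) + 1}.
  -- Classes nonempty = f surjective.  For all i ≤ j, each vertex of V_j has
  -- a neighbour in V_i (for i = j the neighbour is another vertex, automatic
  -- since the graph has no loops).
  IsTTP : (k : ℕ) → (Fin n → Fin k) → Set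
  IsTTP k f = Surjective _≡_ _≡_ f
            × (∀ v (i : Fin k) → toℕ i ≤ toℕ (f v) → ∃[ u ] (Adj v u × f u ≡ i))

  TTR : Fin n → ℕ → Set
  TTR v t = (∃[ k ] ∃[ f ] (IsTTP k f × suc (toℕ (f v)) ≡ t))
          × (∀ k f → IsTTP k f → suc (toℕ (f v)) ≤ t)

{-# OPTIONS --safe #-}
-- Merging the classes V_i, …, V_k of a total transitive partition into one class
-- V_i keeps it total transitive: neighbours in the classes below i are untouched,
-- and every vertex of the merged class already had a neighbour in V_i.  No class
-- becomes empty, since v lies in the merged class and so has a neighbour in each
-- lower one.
module Submission where

open import Defs
open import Data.Nat using (ℕ; suc; _≤_; _⊓_; s≤s; s≤s⁻¹)
open import Data.Nat.Properties using (m⊓n≤m; m⊓n≤n; m≤n⇒m⊓n≡m; m≥n⇒m⊓n≡n; ≤-trans; ≤-<-trans)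
open import Data.Fin using (Fin; toℕ; fromℕ<)
open import Data.Fin.Properties using (toℕ-fromℕ<; toℕ-injective; toℕ<n)
open import Data.Product using (∃-syntax; _×_; _,_)
open import Function using (_∘_; Surjective)
open import Relation.Binary.PropositionalEquality using (_≡_; refl; sym; trans; cong; subst; module ≡-Reasoning)

clamp : ∀ {k} (m : ℕ) → Fin k → Fin (suc m)
clamp m x = fromℕ< (s≤s (m⊓n≤n (toℕ x) m))

toℕ-clamp : ∀ {k} m (x : Fin k) → toℕ (clamp m x) ≡ toℕ x ⊓ m
toℕ-clamp m x = toℕ-fromℕ< (s≤s (m⊓n≤n (toℕ x) m))

clamp-≤ : ∀ {k} m (x : Fin k) → toℕ (clamp m x) ≤ toℕ x
clamp-≤ m x = subst (_≤ toℕ x) (sym (toℕ-clamp m x)) (m⊓n≤m (toℕ x) m)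

toℕ-clamp-top : ∀ {k} m (x : Fin k) → m ≤ toℕ x → toℕ (clamp m x) ≡ m
toℕ-clamp-top m x m≤x = trans (toℕ-clamp m x) (m≥n⇒m⊓n≡n m≤x)

clamp-toℕ : ∀ {k m} (x : Fin k) (j : Fin (suc m)) → toℕ x ≡ toℕ j → clamp m x ≡ j
clamp-toℕ {m = m} x j x≡j = toℕ-injective (begin
  toℕ (clamp m x)  ≡⟨ toℕ-clamp m x ⟩
  toℕ x ⊓ m        ≡⟨ cong (_⊓ m) x≡j ⟩
  toℕ j ⊓ m        ≡⟨ m≤n⇒m⊓n≡m (s≤s⁻¹ (toℕ<n j)) ⟩
  toℕ j            ∎)
  where open ≡-Reasoning

module _ {n : ℕ} (G : Graph n) where

  LowerNeighbours : (k : ℕ) → (Fin n → Fin k) → Set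
  LowerNeighbours k f = ∀ v (i : Fin k) → toℕ i ≤ toℕ (f v) → ∃[ u ] (Adj G v u × f u ≡ i)

  lowerNeighbours-clamp : ∀ {k} {f : Fin n → Fin k} (m : ℕ) →
                          LowerNeighbours k f → LowerNeighbours (suc m) (clamp m ∘ f)
  lowerNeighbours-clamp {f = f} m lower w j j≤w = neighbourIn (lower w (fromℕ< j<k) j′≤fw)
    where
      j≤fw : toℕ j ≤ toℕ (f w)
      j≤fw = ≤-trans j≤w (clamp-≤ m (f w))
      j<k = ≤-<-trans j≤fw (toℕ<n (f w))
      j′≤fw = subst (_≤ toℕ (f w)) (sym (toℕ-fromℕ< j<k)) j≤fw
      neighbourIn : ∃[ u ] (Adj G w u × f u ≡ fromℕ< j<k) → ∃[ u ] (Adj G w u × clamp m (f u) ≡ j)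
      neighbourIn (u , w~u , fu≡j′) = u , w~u , clamp-toℕ (f u) j (trans (cong toℕ fu≡j′) (toℕ-fromℕ< j<k))

  surjective-clamp : ∀ {k} {f : Fin n → Fin k} (m : ℕ) (v : Fin n) →
                     LowerNeighbours k f → m ≤ toℕ (f v) → Surjective _≡_ _≡_ (clamp m ∘ f)
  surjective-clamp {f = f} m v lower m≤fv j =
    let u , _ , fu≡j = lowerNeighbours-clamp m lower v j j≤fv in u , λ { refl → fu≡j }
    where
      j≤fv : toℕ j ≤ toℕ (clamp m (f v))
      j≤fv = subst (toℕ j ≤_) (sym (toℕ-clamp-top m (f v) m≤fv)) (s≤s⁻¹ (toℕ<n j))

  isTTP-clamp : ∀ {k} {f : Fin n → Fin k} (m : ℕ) (v : Fin n) →
                IsTTP G k f → m ≤ toℕ (f v) → IsTTP G (suc m) (clamp m ∘ f)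
  isTTP-clamp m v (_ , lower) m≤fv = surjective-clamp m v lower m≤fv , lowerNeighbours-clamp m lower

lemma6 : (n : ℕ) → 2 ≤ n → (T : Graph n) → IsTree T → (v : Fin n) → (t : ℕ) →
         TTR T v t → (i : ℕ) → 1 ≤ i → i ≤ t →
         ∃[ f ] (IsTTP T i f × suc (toℕ (f v)) ≡ i)
lemma6 n _ T _ v t ((k , f , ttp , v∈Vt) , _) (suc m) _ i≤t =
  clamp m ∘ f , isTTP-clamp T m v ttp m≤fv , cong suc (toℕ-clamp-top m (f v) m≤fv)
  where
    m≤fv : m ≤ toℕ (f v)
    m≤fv = s≤s⁻¹ (subst (suc m ≤_) (sym v∈Vt) i≤t)
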